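{- Let $D$ be a finite homomorphism-homogeneous reflexive bidirectionally disconnected improper digraph with no back-and-forth. Then for all distinct $S,T\in V(D)/\theta(D)$, either $S\not\sim T$, or $S\rightrightarrows T$, or $T\rightrightarrows S$.
   Context: Digraph $D=(V,E)$, $V$ finite; $x\to y$ means $(x,y)\in E$, $x\rightleftarrows y$ means both directions. Reflexive: all loops; improper: $E$ neither symmetric nor antisymmetric. For nonempty $X,Y\subseteq V$: $X\to Y$ means some $x\in X,y\in Y$ with $x\to y$; $X\sim Y$: $X\to Y$ or $Y\to X$; $X\rightleftarrows Y$: $X\to Y$ and $Y\to X$; $X\rightrightarrows Y$: $x\to y$ for all $x\in X,y\in Y$. Homomorphism-homogeneous: every homomorphism $D[U]\to D[W]$ between induced subdigraphs ($U,W$ nonempty) extends to an endomorphism. $\omega(D)$: number of weak components; $(x,y)\in\theta(D)$ iff $x=y$ or $x=z_1\rightleftarrows\cdots\rightleftarrows z_k=y$; bidirectionally disconnected: $\omega(D)<|V/\theta(D)|$. No back-and-forth: for all $S,T\in V/\theta(D)$, $S\rightleftarrows T$ implies $S=T$. -}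

module Defs where

open import Data.Nat using (ℕ; _<_)
open import Data.Fin using (Fin)
open import Data.Fin.Subset using (Subset; _∈_; Nonempty)
open import Data.Bool using (Bool; true)
open import Data.Product using (Σ; ∃; ∃-syntax; _×_; _,_; proj₁)
open import Data.Sum using (_⊎_)
open import Relation.Nullary using (¬_)
open import Relation.Binary.PropositionalEquality using (_≡_)
open import Relation.Binary.Construct.Closure.ReflexiveTransitive using (Star)
open import Function using (Surjective)

record Digraph : Set where
  field
    n   : ℕ
    adj : Fin n → Fin n → Bool

module _ (D : Digraph) where
  open Digraph D

  V : Set
  V = Fin n

  Edge : V → V → Set
  Edge x y = adj x y ≡ true

  Reflexive : Set
  Reflexive = ∀ x → Edge x x

  SymmetricE : Set
  SymmetricE = ∀ x y → Edge x y → Edge y x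

  AntisymmetricE : Set
  AntisymmetricE = ∀ x y → Edge x y → Edge y x → x ≡ y

  Improper : Set
  Improper = ¬ SymmetricE × ¬ AntisymmetricE

  record Hom (U W : Subset n) : Set where
    field
      f        : Σ V (_∈ U) → V
      into     : ∀ u → f u ∈ W
      preserve : ∀ u v → Edge (proj₁ u) (proj₁ v) → Edge (f u) (f v)

  Endo : Set
  Endo = Σ (V → V) λ g → ∀ x y → Edge x y → Edge (g x) (g y)

  HomHomogeneous : Set
  HomHomogeneous = ∀ (U W : Subset n) → Nonempty U → Nonempty W → (h : Hom U W) →
    Σ Endo λ g → ∀ u → proj₁ g (proj₁ u) ≡ Hom.f h u

  BiEdge : V → V → Set
  BiEdge x y = Edge x y × Edge y x

  θ : V → V → Set
  θ = Star BiEdge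

  WeakEdge : V → V → Set
  WeakEdge x y = Edge x y ⊎ Edge y x

  WeaklyConnected : V → V → Set
  WeaklyConnected = Star WeakEdge

  NumClasses : (V → V → Set) → ℕ → Set
  NumClasses R k = Σ (V → Fin k) λ c → Surjective _≡_ _≡_ c ×
    (∀ x y → (R x y → c x ≡ c y) × (c x ≡ c y → R x y))

  BidirectionallyDisconnected : Set
  BidirectionallyDisconnected = ∃[ ω ] ∃[ m ]
    (NumClasses WeaklyConnected ω × NumClasses θ m × ω < m)

  -- classes [x]θ, [y]θ:  [x] → [y]
  ClassTo : V → V → Set
  ClassTo x y = ∃[ a ] ∃[ b ] (θ x a × θ y b × Edge a b)

  ClassSim : V → V → Set
  ClassSim x y = ClassTo x y ⊎ ClassTo y x

  ClassAll : V → V → Set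
  ClassAll x y = ∀ a b → θ x a → θ y b → Edge a b

  NoBackAndForth : Set
  NoBackAndForth = ∀ x y → ClassTo x y → ClassTo y x → θ x y

-- Take distinct θ-classes S ∋ x and T ∋ y with S → T. If some a ∈ S
-- and b ∈ T had a ↛ b, then either b → a, giving T → S outright, or a and b are
-- non-adjacent; in the latter case the transposition of a and b is a homomorphism
-- of D[{a, b}] (loops are present), so homomorphism-homogeneity extends it to an
-- endomorphism g. Endomorphisms preserve ⇄ and hence θ, so g maps S into T and
-- T into S, and the edge witnessing S → T is sent to one witnessing T → S. Either
-- way S ⇄ T, contradicting no back-and-forth. The same argument with a = x, b = y
-- shows that when x and y are non-adjacent the classes are not adjacent at all.
module Submission where

open import Defs
open import Data.Bool using (true; false)
open import Data.Empty using (⊥-elim)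
open import Data.Fin using (_≟_)
open import Data.Fin.Subset using (Subset; ⁅_⁆; _∪_; _∈_)
open import Data.Fin.Subset.Properties using (x∈⁅x⁆; x∈⁅y⁆⇒x≡y; x∈p∪q⁻; x∈p∪q⁺)
open import Data.Product using (_×_; _,_; proj₁; proj₂; Σ)
open import Data.Sum using (_⊎_; inj₁; inj₂)
open import Relation.Binary.Construct.Closure.ReflexiveTransitive using (ε; _◅◅_; gmap; reverse)
open import Relation.Binary.PropositionalEquality using (_≡_; refl; sym; trans; subst; subst₂)
open import Function using (_∘_)
open import Relation.Nullary using (¬_; Dec; yes; no)

module _ (D : Digraph) where
  open Digraph D

  Edge? : ∀ u v → Dec (Edge D u v)
  Edge? u v with adj u v
  ... | true  = yes refl
  ... | false = no λ ()

  Nonadjacent : V D → V D → Set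
  Nonadjacent a b = ¬ Edge D a b × ¬ Edge D b a

  θ-sym : ∀ {u v} → θ D u v → θ D v u
  θ-sym = reverse λ { (p , q) → q , p }

  ClassTo-resp-θ : ∀ {x x′ y y′} → θ D x x′ → θ D y y′ → ClassTo D x y → ClassTo D x′ y′
  ClassTo-resp-θ xx′ yy′ (a , b , xa , yb , ab) = a , b , θ-sym xx′ ◅◅ xa , θ-sym yy′ ◅◅ yb , ab

  module _ (g : Endo D) where
    private
      g₀ : V D → V D
      g₀ = proj₁ g

      g-edge : ∀ u v → Edge D u v → Edge D (g₀ u) (g₀ v)
      g-edge = proj₂ g

    Endo-preserves-θ : ∀ {u v} → θ D u v → θ D (g₀ u) (g₀ v)
    Endo-preserves-θ = gmap g₀ λ { (p , q) → g-edge _ _ p , g-edge _ _ q }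

    Endo-preserves-ClassTo : ∀ {x y} → ClassTo D x y → ClassTo D (g₀ x) (g₀ y)
    Endo-preserves-ClassTo (a , b , xa , yb , ab) =
      g₀ a , g₀ b , Endo-preserves-θ xa , Endo-preserves-θ yb , g-edge a b ab

  transposition-of-nonadjacent : HomHomogeneous D → Reflexive D → ∀ {a b} → Nonadjacent a b →
    Σ (Endo D) λ g → proj₁ g a ≡ b × proj₁ g b ≡ a
  transposition-of-nonadjacent hh loop {a} {b} (a↛b , b↛a) =
    g , trans (extends (a , a∈U)) swap-a , trans (extends (b , b∈U)) swap-b
    where
    U : Subset n
    U = ⁅ a ⁆ ∪ ⁅ b ⁆

    a∈U : a ∈ U
    a∈U = x∈p∪q⁺ (inj₁ (x∈⁅x⁆ a))

    b∈U : b ∈ U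
    b∈U = x∈p∪q⁺ (inj₂ (x∈⁅x⁆ b))

    ∈U⇒a⊎b : ∀ {u} → u ∈ U → u ≡ a ⊎ u ≡ b
    ∈U⇒a⊎b u∈U with x∈p∪q⁻ ⁅ a ⁆ ⁅ b ⁆ u∈U
    ... | inj₁ p = inj₁ (x∈⁅y⁆⇒x≡y a p)
    ... | inj₂ p = inj₂ (x∈⁅y⁆⇒x≡y b p)

    swap : V D → V D
    swap u with u ≟ a
    ... | yes _ = b
    ... | no  _ = a

    swap-a : swap a ≡ b
    swap-a with a ≟ a
    ... | yes _   = refl
    ... | no  a≢a = ⊥-elim (a≢a refl)

    swap-b : swap b ≡ a
    swap-b with b ≟ a
    ... | yes refl = ⊥-elim (a↛b (loop a))
    ... | no  _    = refl

    swap-into : ∀ {u} → u ∈ U → swap u ∈ U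
    swap-into u∈U with ∈U⇒a⊎b u∈U
    ... | inj₁ refl = subst (_∈ U) (sym swap-a) b∈U
    ... | inj₂ refl = subst (_∈ U) (sym swap-b) a∈U

    swap-edge : ∀ {u v} → u ∈ U → v ∈ U → Edge D u v → Edge D (swap u) (swap v)
    swap-edge u∈U v∈U e with ∈U⇒a⊎b u∈U | ∈U⇒a⊎b v∈U
    ... | inj₁ refl | inj₁ refl = loop _
    ... | inj₂ refl | inj₂ refl = loop _
    ... | inj₁ refl | inj₂ refl = ⊥-elim (a↛b e)
    ... | inj₂ refl | inj₁ refl = ⊥-elim (b↛a e)

    swap-hom : Hom D U U
    swap-hom = record
      { f        = λ u → swap (proj₁ u)
      ; into     = λ u → swap-into (proj₂ u)
      ; preserve = λ u v → swap-edge (proj₂ u) (proj₂ v)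
      }

    extension : Σ (Endo D) λ g → ∀ u → proj₁ g (proj₁ u) ≡ swap (proj₁ u)
    extension = hh U U (a , a∈U) (a , a∈U) swap-hom

    g : Endo D
    g = proj₁ extension

    extends : ∀ (u : Σ (V D) (_∈ U)) → proj₁ g (proj₁ u) ≡ swap (proj₁ u)
    extends = proj₂ extension

  module _ (hh : HomHomogeneous D) (loop : Reflexive D) where

    ClassTo-reverse-via-nonadjacent : ∀ {x y a b} → θ D x a → θ D y b → Nonadjacent a b →
      ClassTo D x y → ClassTo D y x
    ClassTo-reverse-via-nonadjacent xa yb a≁b x→y
      with transposition-of-nonadjacent hh loop a≁b
    ... | g , ga≡b , gb≡a =
      ClassTo-resp-θ (θ-sym yb) (θ-sym xa)
        (subst₂ (ClassTo D) ga≡b gb≡a (Endo-preserves-ClassTo g (ClassTo-resp-θ xa yb x→y)))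

    module _ (nbf : NoBackAndForth D) where

      ClassTo⇒ClassAll : ∀ {x y} → ¬ θ D x y → ClassTo D x y → ClassAll D x y
      ClassTo⇒ClassAll {x} {y} ¬xθy x→y a b xa yb with Edge? a b
      ... | yes a→b = a→b
      ... | no  a↛b with Edge? b a
      ... | yes b→a = ⊥-elim (¬xθy (nbf x y x→y (b , a , yb , xa , b→a)))
      ... | no  b↛a = ⊥-elim (¬xθy (nbf x y x→y
                        (ClassTo-reverse-via-nonadjacent xa yb (a↛b , b↛a) x→y)))

      nonadjacent⇒¬ClassSim : ∀ {x y} → ¬ θ D x y → Nonadjacent x y → ¬ ClassSim D x y
      nonadjacent⇒¬ClassSim ¬xθy x≁y (inj₁ x→y) =
        ¬xθy (nbf _ _ x→y (ClassTo-reverse-via-nonadjacent ε ε x≁y x→y))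
      nonadjacent⇒¬ClassSim ¬xθy (x↛y , y↛x) (inj₂ y→x) =
        ¬xθy (nbf _ _ (ClassTo-reverse-via-nonadjacent ε ε (y↛x , x↛y) y→x) y→x)

lemma5p5 : (D : Digraph) → HomHomogeneous D → Reflexive D → BidirectionallyDisconnected D →
    Improper D → NoBackAndForth D →
    ∀ x y → ¬ θ D x y → ¬ ClassSim D x y ⊎ ClassAll D x y ⊎ ClassAll D y x
lemma5p5 D hh loop _ _ nbf x y ¬xθy with Edge? D x y | Edge? D y x
... | yes x→y | _        = inj₂ (inj₁ (ClassTo⇒ClassAll D hh loop nbf ¬xθy (x , y , ε , ε , x→y)))
... | no  _   | yes y→x  = inj₂ (inj₂ (ClassTo⇒ClassAll D hh loop nbf (¬xθy ∘ θ-sym D) (y , x , ε , ε , y→x)))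
... | no  x↛y | no  y↛x  = inj₁ (nonadjacent⇒¬ClassSim D hh loop nbf ¬xθy (x↛y , y↛x))
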